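{- Let $p$ be an odd prime and $z$ a nonzero integer with $\gcd(p,z)=1$. Then for each $r\in\mathbb{N}$ there is a $p$-adic integer $c_r$, depending only on $r$ (for the given $z$), such that $$\sum_{k=0}^{p-1}(2k+1)^{2r+2}D_k(z)\equiv c_r \sum_{k=0}^{p-1}D_k(z) \pmod {p}.$$
   Context: The central Delannoy polynomials are $D_k(z)=\sum_{i=0}^{k}\binom{k}{i}\binom{k+i}{i}z^i$ for $k\in\mathbb{N}=\{0,1,2,\dots\}$. -}

module Defs where

open import Data.Nat as ℕ using (ℕ; zero; suc)
open import Data.Nat.Combinatorics using (_C_)
open import Data.Integer as ℤ using (ℤ; +_)
open import Data.Integer.Divisibility as ℤD using ()
open import Data.Rational using (ℚ; ↥_; ↧_)

sumBelow : ℕ → (ℕ → ℤ) → ℤ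
sumBelow zero    f = + 0
sumBelow (suc n) f = sumBelow n f ℤ.+ f n

D : ℕ → ℤ → ℤ
D k z = sumBelow (suc k) (λ i → (+ ((k C i) ℕ.* ((k ℕ.+ i) C i))) ℤ.* (z ℤ.^ i))

-- a ≡ c * b (mod p) for integers a b and a rational c (p-adically integral):
-- p divides the numerator of a - c*b, i.e. p ∣ a·den(c) − num(c)·b
CongModQ : ℤ → ℚ → ℤ → ℕ → Set
CongModQ a c b p = (+ p) ℤD.∣ ((a ℤ.* (↧ c)) ℤ.- ((↥ c) ℤ.* b))

-- Write D_k(z) = Σ_i a(k,i) z^i with a(k,i) = C(k,i) C(k+i,i) (D-coeff), fix p = 2n+1 and put
-- U(m,i) = Σ_{k<p} (2k+1)^{2m} a(k,i) (coeffMoment), so that Σ_{k<p} (2k+1)^{2m} D_k(z) = Σ_i z^i U(m,i).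
-- Since (2k+1)^2 − (2i+1)^2 = 4(k−i)(k+i+1) and (i+1)^2 a(k,i+1) = (k−i)(k+i+1) a(k,i),
-- the moments satisfy U(m+1,i) = (2i+1)^2 U(m,i) + (2i+2)^2 U(m,i+1).  Modulo p we have
-- U(m,i) ≡ 0 for i > n (p divides a(k,i) when k < p), U(0,i) ≡ 0 for i < n (because
-- (2i+1) Σ_{k<N} a(k,i) = (N−i) a(N,i)), and 2i+1 ≡ −2(n−i), 2i+2 ≡ −(2(n−i)−1).  So
-- U(m,n−d) ≡ β(m,d) U(0,n) with integers β(m,d) that do not depend on p.  As β(m,d) = 0 for d > m
-- and p ∣ β(m,d) for d > n, summing against z^i gives
-- z^m Σ_k (2k+1)^{2m} D_k(z) ≡ (Σ_{d≤m} β(m,d) z^{m−d}) Σ_k D_k(z).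

module Submission where

open import Defs
open import Data.Nat as ℕ using (ℕ; zero; suc)
import Data.Nat.Properties as ℕₚ
open import Data.Nat.Combinatorics using (_C_; k>n⇒nCk≡0; nC1≡n)
  renaming (nCk+nC[k+1]≡[n+1]C[k+1] to pascal)
open import Data.Nat.Divisibility as ℕ∣ using (_∣_; divides; >⇒∤)
open import Data.Nat.Primality using (Prime; euclidsLemma; prime⇒nonZero; prime⇒nonTrivial; prime⇒irreducible)
open import Data.Nat.GCD using (gcd; gcd-greatest)
open import Data.Sum using (_⊎_; inj₁; inj₂)
open import Data.Product using (Σ; _×_; _,_)
open import Data.Empty using (⊥-elim)
open import Relation.Nullary using (¬_; yes; no)
open import Relation.Binary.PropositionalEquality

module _ where
  open import Data.Nat.Base using (_+_; _*_; _∸_; _^_; _≤_; _<_; s≤s; z<s)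
  open import Data.Nat.Properties
  open import Data.Nat.Tactic.RingSolver using (solve-∀)
  open ≡-Reasoning

  C-absorb : ∀ n k → suc k * (suc n C suc k) ≡ suc n * (n C k)
  C-absorb n       zero    = trans (*-identityˡ _) (trans (nC1≡n (suc n)) (sym (*-identityʳ (suc n))))
  C-absorb zero    (suc k) = *-zeroʳ (suc (suc k))
  C-absorb (suc n) (suc k) = begin
    suc (suc k) * (suc (suc n) C suc (suc k))     ≡⟨ cong (suc (suc k) *_) (pascal (suc n) (suc k)) ⟨
    suc (suc k) * (X + Y)                         ≡⟨ distrib (suc k) X Y ⟩
    X + (suc k * X + suc (suc k) * Y)             ≡⟨ cong (X +_) (cong₂ _+_ (C-absorb n k) (C-absorb n (suc k))) ⟩
    X + (suc n * (n C k) + suc n * (n C suc k))   ≡⟨ cong (X +_) (*-distribˡ-+ (suc n) (n C k) _) ⟨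
    X + suc n * (n C k + n C suc k)               ≡⟨ cong (λ t → X + suc n * t) (pascal n k) ⟩
    suc (suc n) * X                               ∎
    where
    X Y : ℕ
    X = suc n C suc k
    Y = suc n C suc (suc k)
    distrib : ∀ a x y → suc a * (x + y) ≡ x + (a * x + suc a * y)
    distrib = solve-∀

  C-succ-ratio : ∀ j i → suc i * ((j + i) C suc i) ≡ j * ((j + i) C i)
  C-succ-ratio j i = +-cancelˡ-≡ (suc i * A) _ _ (begin
    suc i * A + suc i * ((j + i) C suc i)  ≡⟨ *-distribˡ-+ (suc i) A _ ⟨
    suc i * (A + (j + i) C suc i)          ≡⟨ cong (suc i *_) (pascal (j + i) i) ⟩
    suc i * (suc (j + i) C suc i)          ≡⟨ C-absorb (j + i) i ⟩
    suc (j + i) * A                        ≡⟨ split j i A ⟩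
    suc i * A + j * A                      ∎)
    where
    A : ℕ
    A = (j + i) C i
    split : ∀ j i a → suc (j + i) * a ≡ suc i * a + j * a
    split = solve-∀

  C-absorb-upper : ∀ j i → suc j * (suc (j + i) C i) ≡ suc (j + i) * ((j + i) C i)
  C-absorb-upper j i = trans (sym (C-succ-ratio (suc j) i)) (C-absorb (j + i) i)

  prime∣C : ∀ {p} → Prime p → ∀ k n → k < p → p ≤ n → n < p + k → p ∣ n C k
  prime∣C {p} pp zero n _ p≤n n<p+0 = ⊥-elim (<⇒≱ (subst (n <_) (+-identityʳ p) n<p+0) p≤n)
  prime∣C {p} pp (suc k) zero _ p≤0 _ = ⊥-elim (ℕ.≢-nonZero⁻¹ p {{prime⇒nonZero pp}} (n≤0⇒n≡0 p≤0))
  prime∣C {p} pp (suc k) (suc n) k<p p≤n n<p+k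
    with euclidsLemma (suc k) (suc n C suc k) pp (subst (p ∣_) (sym (C-absorb n k)) p∣rhs)
    where
    p∣rhs : p ∣ suc n * (n C k)
    p∣rhs with m≤n⇒m<n∨m≡n p≤n
    ... | inj₂ refl        = ℕ∣.m∣m*n (n C k)
    ... | inj₁ (s≤s p≤n′) = ℕ∣.∣n⇒∣m*n (suc n)
      (prime∣C pp k n (<-trans (n<1+n k) k<p) p≤n′ (+-cancelˡ-< 1 n (p + k) (subst (suc n <_) (+-suc p k) n<p+k)))
  ... | inj₁ p∣k+1 = ⊥-elim (>⇒∤ k<p p∣k+1)
  ... | inj₂ p∣C   = p∣C

  data Offset (i : ℕ) : ℕ → Set where
    below : ∀ {k} → k < i → Offset i k
    above : ∀ j → Offset i (j + i)

  offset : ∀ i k → Offset i k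
  offset i k with k <? i
  ... | yes k<i = below k<i
  ... | no k≮i with j , refl ← m≤n⇒∃[o]m+o≡n (≮⇒≥ k≮i) = subst (Offset i) (+-comm j i) (above j)

  D-coeff : ℕ → ℕ → ℕ
  D-coeff k i = (k C i) * ((k + i) C i)

  D-coeff-below : ∀ {k i} → k < i → D-coeff k i ≡ 0
  D-coeff-below {k} {i} k<i = cong (_* ((k + i) C i)) (k>n⇒nCk≡0 k<i)

  D-coeff-succ : ∀ j i → suc i * suc i * D-coeff (j + i) (suc i) ≡ j * suc (j + i + i) * D-coeff (j + i) i
  D-coeff-succ j i = begin
    suc i * suc i * (X * ((j + i + suc i) C suc i))    ≡⟨ cong (λ t → suc i * suc i * (X * (t C suc i))) (+-suc (j + i) i) ⟩
    suc i * suc i * (X * (suc (j + i + i) C suc i))    ≡⟨ regroup (suc i) X (suc (j + i + i) C suc i) ⟩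
    (suc i * X) * (suc i * (suc (j + i + i) C suc i))  ≡⟨ cong₂ _*_ (C-succ-ratio j i) (C-absorb (j + i + i) i) ⟩
    (j * A) * (suc (j + i + i) * B)                    ≡⟨ regroup′ j A (suc (j + i + i)) B ⟩
    j * suc (j + i + i) * (A * B)                      ∎
    where
    X A B : ℕ
    X = (j + i) C suc i
    A = (j + i) C i
    B = (j + i + i) C i
    regroup : ∀ a x y → a * a * (x * y) ≡ (a * x) * (a * y)
    regroup = solve-∀
    regroup′ : ∀ a x b y → (a * x) * (b * y) ≡ a * b * (x * y)
    regroup′ = solve-∀

  D-coeff-recurrence : ∀ k i → (2 * k + 1) * (2 * k + 1) * D-coeff k i
    ≡ (2 * i + 1) * (2 * i + 1) * D-coeff k i + (2 * i + 2) * (2 * i + 2) * D-coeff k (suc i)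
  D-coeff-recurrence k i with offset i k
  ... | below k<i rewrite D-coeff-below k<i | D-coeff-below (m<n⇒m<1+n k<i) = zeros (2 * k + 1) (2 * i + 1) (2 * i + 2)
    where
    zeros : ∀ a b c → a * a * 0 ≡ b * b * 0 + c * c * 0
    zeros = solve-∀
  ... | above j = begin
    (2 * (j + i) + 1) * (2 * (j + i) + 1) * δ                  ≡⟨ expand j i δ ⟩
    (2 * i + 1) * (2 * i + 1) * δ + 4 * (j * suc (j + i + i) * δ)
      ≡⟨ cong (λ t → (2 * i + 1) * (2 * i + 1) * δ + 4 * t) (D-coeff-succ j i) ⟨
    (2 * i + 1) * (2 * i + 1) * δ + 4 * (suc i * suc i * δ′)   ≡⟨ cong ((2 * i + 1) * (2 * i + 1) * δ +_) (square i δ′) ⟩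
    (2 * i + 1) * (2 * i + 1) * δ + (2 * i + 2) * (2 * i + 2) * δ′ ∎
    where
    δ δ′ : ℕ
    δ = D-coeff (j + i) i
    δ′ = D-coeff (j + i) (suc i)
    expand : ∀ j i x → (2 * (j + i) + 1) * (2 * (j + i) + 1) * x
                       ≡ (2 * i + 1) * (2 * i + 1) * x + 4 * (j * suc (j + i + i) * x)
    expand = solve-∀
    square : ∀ i x → 4 * (suc i * suc i * x) ≡ (2 * i + 2) * (2 * i + 2) * x
    square = solve-∀

  D-coeff-step : ∀ j i → suc j * D-coeff (suc (j + i)) i ≡ suc (j + i + i) * D-coeff (j + i) i
  D-coeff-step j i = *-cancelˡ-≡ _ _ (suc (j + i)) (begin
    suc (j + i) * (suc j * (A′ * B′))          ≡⟨ regroup (suc (j + i)) (suc j) A′ B′ ⟩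
    (suc j * A′) * (suc (j + i) * B′)          ≡⟨ cong₂ _*_ (C-absorb-upper j i) (C-absorb-upper (j + i) i) ⟩
    (suc (j + i) * A) * (suc (j + i + i) * B)  ≡⟨ regroup′ (suc (j + i)) A (suc (j + i + i)) B ⟩
    suc (j + i) * (suc (j + i + i) * (A * B))  ∎)
    where
    A B A′ B′ : ℕ
    A = (j + i) C i
    B = (j + i + i) C i
    A′ = suc (j + i) C i
    B′ = suc (j + i + i) C i
    regroup : ∀ n a x y → n * (a * (x * y)) ≡ (a * x) * (n * y)
    regroup = solve-∀
    regroup′ : ∀ n x b y → (n * x) * (b * y) ≡ n * (b * (x * y))
    regroup′ = solve-∀

  D-coeff-sum-step : ∀ i N →
    (2 * i + 1) * D-coeff N i + (N ∸ i) * D-coeff N i ≡ (suc N ∸ i) * D-coeff (suc N) i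
  D-coeff-sum-step i N with offset i N
  ... | below N<i rewrite D-coeff-below N<i | m≤n⇒m∸n≡0 N<i = zeros (2 * i + 1) (N ∸ i)
    where
    zeros : ∀ a b → a * 0 + b * 0 ≡ 0
    zeros = solve-∀
  ... | above j = begin
    (2 * i + 1) * δ + (j + i ∸ i) * δ    ≡⟨ cong (λ t → (2 * i + 1) * δ + t * δ) (m+n∸n≡m j i) ⟩
    (2 * i + 1) * δ + j * δ              ≡⟨ collect i j δ ⟩
    suc (j + i + i) * δ                  ≡⟨ D-coeff-step j i ⟨
    suc j * δ′                           ≡⟨ cong (_* δ′) (m+n∸n≡m (suc j) i) ⟨
    (suc (j + i) ∸ i) * δ′               ∎
    where
    δ δ′ : ℕ
    δ = D-coeff (j + i) i
    δ′ = D-coeff (suc (j + i)) i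
    collect : ∀ i j x → (2 * i + 1) * x + j * x ≡ suc (j + i + i) * x
    collect = solve-∀

  prime∣D-coeff : ∀ {p k i} → Prime p → k < p → p ≤ i + i → p ∣ D-coeff k i
  prime∣D-coeff {p} {k} {i} pp k<p p≤2i with offset i k
  ... | below k<i = subst (p ∣_) (sym (D-coeff-below k<i)) (p ℕ∣.∣0)
  ... | above j = ℕ∣.∣n⇒∣m*n ((j + i) C i)
    (prime∣C pp i (j + i + i) (≤-<-trans (m≤n+m i j) k<p) (≤-trans p≤2i (+-monoˡ-≤ i (m≤n+m i j))) (+-monoˡ-< i k<p))

  prime∣[p∸i]*D-coeff : ∀ {p} i → Prime p → i < p → p ∣ (p ∸ i) * D-coeff p i
  prime∣[p∸i]*D-coeff {p} zero    pp _   = ℕ∣.m∣m*n (D-coeff p 0)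
  prime∣[p∸i]*D-coeff {p} (suc i) pp i<p = ℕ∣.∣n⇒∣m*n (p ∸ suc i)
    (ℕ∣.∣m⇒∣m*n ((p + suc i) C suc i) (prime∣C pp (suc i) p i<p ≤-refl (m<m+n p z<s)))

  even⊎odd : ∀ n → Σ ℕ (λ h → n ≡ 2 * h) ⊎ Σ ℕ (λ h → n ≡ 2 * h + 1)
  even⊎odd zero = inj₁ (0 , refl)
  even⊎odd (suc n) with even⊎odd n
  ... | inj₁ (h , refl) = inj₂ (h , +-comm 1 (2 * h))
  ... | inj₂ (h , refl) = inj₁ (suc h , next h)
    where
    next : ∀ h → suc (2 * h + 1) ≡ 2 * suc h
    next = solve-∀

  odd-prime : ∀ {p} → Prime p → p ≢ 2 → Σ ℕ (λ n → p ≡ 2 * n + 1)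
  odd-prime {p} pp p≢2 with even⊎odd p
  ... | inj₂ odd = odd
  ... | inj₁ (h , p≡2h) with prime⇒irreducible pp (divides h (trans p≡2h (*-comm 2 h)))
  ...   | inj₁ ()
  ...   | inj₂ 2≡p = ⊥-elim (p≢2 (sym 2≡p))

  prime∤⇐gcd≡1 : ∀ {p a} → Prime p → gcd p a ≡ 1 → ¬ p ∣ a
  prime∤⇐gcd≡1 {p} pp gcd≡1 p∣a =
    ℕ.nonTrivial⇒≢1 {{prime⇒nonTrivial pp}} (ℕ∣.∣1⇒≡1 (subst (p ∣_) gcd≡1 (gcd-greatest ℕ∣.∣-refl p∣a)))

  prime∤^ : ∀ {p a} → Prime p → ¬ p ∣ a → ∀ m → ¬ p ∣ a ^ m
  prime∤^ pp p∤a zero    p∣1 = ℕ.nonTrivial⇒≢1 {{prime⇒nonTrivial pp}} (ℕ∣.∣1⇒≡1 p∣1)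
  prime∤^ {a = a} pp p∤a (suc m) p∣aᵐ⁺¹ with euclidsLemma a (a ^ m) pp p∣aᵐ⁺¹
  ... | inj₁ p∣a  = p∤a p∣a
  ... | inj₂ p∣aᵐ = prime∤^ pp p∤a m p∣aᵐ

  prime∤* : ∀ {p a b} → Prime p → ¬ p ∣ a → ¬ p ∣ b → ¬ p ∣ a * b
  prime∤* {a = a} {b} pp p∤a p∤b p∣ab with euclidsLemma a b pp p∣ab
  ... | inj₁ p∣a = p∤a p∣a
  ... | inj₂ p∣b = p∤b p∣b

open import Data.Integer as ℤ using (ℤ; +_; ∣_∣)

open import Data.Nat.Base using (_<_)
open import Data.Integer.Base using (_+_; _*_; _-_; -_; _^_; 0ℤ; 1ℤ)
open import Data.Integer.Properties
open import Data.Integer.Tactic.RingSolver using (solve-∀)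
open import Data.Nat.Tactic.RingSolver using () renaming (solve-∀ to ℕ-solve-∀)
open import Data.Integer.Divisibility.Signed as Signed using (divides)
import Data.Integer.Coprimality as ℤCoprime
open import Data.Nat.Coprimality using (Coprime; prime⇒coprime)
import Data.Integer.GCD as ℤGCD
open import Data.Rational using (ℚ; _/_; ↥_; ↧_; ↧ₙ_)
import Data.Rational.Properties as ℚₚ
open import Relation.Binary.Bundles using (Setoid)
import Relation.Binary.Reasoning.Setoid as SetoidReasoning

abs-^ : ∀ i n → ∣ i ^ n ∣ ≡ ∣ i ∣ ℕ.^ n
abs-^ i zero    = refl
abs-^ i (suc n) = trans (abs-* i (i ^ n)) (cong (∣ i ∣ ℕ.*_) (abs-^ i n))

+∣i∣*+∣i∣≡i*i : ∀ i → + ∣ i ∣ * + ∣ i ∣ ≡ i * i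
+∣i∣*+∣i∣≡i*i i with +∣i∣≡i⊎+∣i∣≡-i i
... | inj₁ +∣i∣≡i  = cong₂ _*_ +∣i∣≡i +∣i∣≡i
... | inj₂ +∣i∣≡-i = trans (cong₂ _*_ +∣i∣≡-i +∣i∣≡-i) (neg*neg i)
  where
  neg*neg : ∀ i → - i * - i ≡ i * i
  neg*neg = solve-∀

+[∣i∣^n*∣i∣^n]≡i^n*i^n : ∀ i n → + (∣ i ∣ ℕ.^ n ℕ.* ∣ i ∣ ℕ.^ n) ≡ i ^ n * i ^ n
+[∣i∣^n*∣i∣^n]≡i^n*i^n i n = begin
  + (∣ i ∣ ℕ.^ n ℕ.* ∣ i ∣ ℕ.^ n)   ≡⟨ cong (λ x → + (x ℕ.* x)) (abs-^ i n) ⟨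
  + (∣ i ^ n ∣ ℕ.* ∣ i ^ n ∣)       ≡⟨ pos-* ∣ i ^ n ∣ ∣ i ^ n ∣ ⟩
  + ∣ i ^ n ∣ * + ∣ i ^ n ∣         ≡⟨ +∣i∣*+∣i∣≡i*i (i ^ n) ⟩
  i ^ n * i ^ n                     ∎
  where open ≡-Reasoning

sumBelow-cong : ∀ N {f g : ℕ → ℤ} → (∀ k → k < N → f k ≡ g k) → sumBelow N f ≡ sumBelow N g
sumBelow-cong zero    _   = refl
sumBelow-cong (suc N) f≡g = cong₂ _+_ (sumBelow-cong N (λ k k<N → f≡g k (ℕₚ.m<n⇒m<1+n k<N))) (f≡g N (ℕₚ.n<1+n N))

sumBelow-zero : ∀ N {f : ℕ → ℤ} → (∀ k → k < N → f k ≡ 0ℤ) → sumBelow N f ≡ 0ℤ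
sumBelow-zero zero    _    = refl
sumBelow-zero (suc N) f≡0 = cong₂ _+_ (sumBelow-zero N (λ k k<N → f≡0 k (ℕₚ.m<n⇒m<1+n k<N))) (f≡0 N (ℕₚ.n<1+n N))

sumBelow-+ : ∀ N (f g : ℕ → ℤ) → sumBelow N (λ k → f k + g k) ≡ sumBelow N f + sumBelow N g
sumBelow-+ zero    f g = refl
sumBelow-+ (suc N) f g = trans (cong (_+ (f N + g N)) (sumBelow-+ N f g)) (interchange (sumBelow N f) (sumBelow N g) (f N) (g N))
  where
  interchange : ∀ a b c d → (a + b) + (c + d) ≡ (a + c) + (b + d)
  interchange = solve-∀

sumBelow-*ˡ : ∀ N c (f : ℕ → ℤ) → sumBelow N (λ k → c * f k) ≡ c * sumBelow N f
sumBelow-*ˡ zero    c f = sym (*-zeroʳ c)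
sumBelow-*ˡ (suc N) c f = trans (cong (_+ c * f N) (sumBelow-*ˡ N c f)) (sym (*-distribˡ-+ c _ (f N)))

sumBelow-*ʳ : ∀ N c (f : ℕ → ℤ) → sumBelow N (λ k → f k * c) ≡ sumBelow N f * c
sumBelow-*ʳ N c f = begin
  sumBelow N (λ k → f k * c)  ≡⟨ sumBelow-cong N (λ k _ → *-comm (f k) c) ⟩
  sumBelow N (λ k → c * f k)  ≡⟨ sumBelow-*ˡ N c f ⟩
  c * sumBelow N f            ≡⟨ *-comm c _ ⟩
  sumBelow N f * c            ∎
  where open ≡-Reasoning

sumBelow-swap : ∀ M N (f : ℕ → ℕ → ℤ) →
  sumBelow M (λ k → sumBelow N (f k)) ≡ sumBelow N (λ i → sumBelow M (λ k → f k i))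
sumBelow-swap zero    N f = sym (sumBelow-zero N (λ _ _ → refl))
sumBelow-swap (suc M) N f = begin
  sumBelow M (λ k → sumBelow N (f k)) + sumBelow N (f M)
    ≡⟨ cong (_+ sumBelow N (f M)) (sumBelow-swap M N f) ⟩
  sumBelow N (λ i → sumBelow M (λ k → f k i)) + sumBelow N (f M)
    ≡⟨ sumBelow-+ N (λ i → sumBelow M (λ k → f k i)) (f M) ⟨
  sumBelow N (λ i → sumBelow (suc M) (λ k → f k i)) ∎
  where open ≡-Reasoning

sumBelow-split : ∀ M N (f : ℕ → ℤ) → sumBelow (M ℕ.+ N) f ≡ sumBelow M f + sumBelow N (λ j → f (M ℕ.+ j))
sumBelow-split M zero    f = trans (cong (λ L → sumBelow L f) (ℕₚ.+-identityʳ M)) (sym (+-identityʳ _))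
sumBelow-split M (suc N) f = begin
  sumBelow (M ℕ.+ suc N) f                                      ≡⟨ cong (λ L → sumBelow L f) (ℕₚ.+-suc M N) ⟩
  sumBelow (M ℕ.+ N) f + f (M ℕ.+ N)                            ≡⟨ cong (_+ f (M ℕ.+ N)) (sumBelow-split M N f) ⟩
  sumBelow M f + sumBelow N (λ j → f (M ℕ.+ j)) + f (M ℕ.+ N)  ≡⟨ +-assoc (sumBelow M f) _ _ ⟩
  sumBelow M f + sumBelow (suc N) (λ j → f (M ℕ.+ j))          ∎
  where open ≡-Reasoning

sumBelow-extend : ∀ M N (f : ℕ → ℤ) → (∀ j → f (M ℕ.+ j) ≡ 0ℤ) → sumBelow (M ℕ.+ N) f ≡ sumBelow M f
sumBelow-extend M N f f≡0 = begin
  sumBelow (M ℕ.+ N) f                           ≡⟨ sumBelow-split M N f ⟩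
  sumBelow M f + sumBelow N (λ j → f (M ℕ.+ j))  ≡⟨ cong (λ t → sumBelow M f + t) (sumBelow-zero N (λ j _ → f≡0 j)) ⟩
  sumBelow M f + 0ℤ                              ≡⟨ +-identityʳ _ ⟩
  sumBelow M f                                   ∎
  where open ≡-Reasoning

sumBelow-reverse : ∀ n (f : ℕ → ℤ) → sumBelow (suc n) f ≡ sumBelow (suc n) (λ i → f (n ℕ.∸ i))
sumBelow-reverse zero    f = refl
sumBelow-reverse (suc n) f = begin
  sumBelow (suc n) f + f (suc n)                          ≡⟨ cong (_+ f (suc n)) (sumBelow-reverse n f) ⟩
  sumBelow (suc n) (λ i → f (n ℕ.∸ i)) + f (suc n)        ≡⟨ +-comm _ (f (suc n)) ⟩
  f (suc n) + sumBelow (suc n) (λ i → f (n ℕ.∸ i))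
    ≡⟨ cong (_+ sumBelow (suc n) (λ i → f (n ℕ.∸ i))) (+-identityˡ (f (suc n))) ⟨
  0ℤ + f (suc n) + sumBelow (suc n) (λ i → f (n ℕ.∸ i))   ≡⟨ sumBelow-split 1 (suc n) (λ i → f (suc n ℕ.∸ i)) ⟨
  sumBelow (suc (suc n)) (λ i → f (suc n ℕ.∸ i))          ∎
  where open ≡-Reasoning

infix 4 _≡_mod_

-- A record rather than an abbreviation, so that a and b can be inferred from a proof.
record _≡_mod_ (a b : ℤ) (p : ℕ) : Set where
  constructor congruent
  field divides-difference : + p Signed.∣ a - b

private
  via : ∀ {p e a b} → e ≡ a - b → + p Signed.∣ e → a ≡ b mod p
  via {p} e≡a-b p∣e = congruent (subst (+ p Signed.∣_) e≡a-b p∣e)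

module _ {p : ℕ} where

  ≡⇒≡-mod : ∀ {a b} → a ≡ b → a ≡ b mod p
  ≡⇒≡-mod {a} refl = via (sym (+-inverseʳ a)) (divides 0ℤ (sym (*-zeroˡ (+ p))))

  mod-sym : ∀ {a b} → a ≡ b mod p → b ≡ a mod p
  mod-sym {a} {b} (congruent p∣a-b) = via (negate a b) (Signed.∣m⇒∣-m p∣a-b)
    where
    negate : ∀ a b → - (a - b) ≡ b - a
    negate = solve-∀

  mod-trans : ∀ {a b c} → a ≡ b mod p → b ≡ c mod p → a ≡ c mod p
  mod-trans {a} {b} {c} (congruent p∣a-b) (congruent p∣b-c) = via (telescope a b c) (Signed.∣m∣n⇒∣m+n p∣a-b p∣b-c)
    where
    telescope : ∀ a b c → (a - b) + (b - c) ≡ a - c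
    telescope = solve-∀

mod-setoid : ℕ → Setoid _ _
mod-setoid p = record
  { Carrier       = ℤ
  ; _≈_           = λ a b → a ≡ b mod p
  ; isEquivalence = record { refl = ≡⇒≡-mod refl ; sym = mod-sym ; trans = mod-trans }
  }

module ≡-mod-Reasoning (p : ℕ) = SetoidReasoning (mod-setoid p)

module _ {p : ℕ} where

  +-cong-mod : ∀ {a b c d} → a ≡ b mod p → c ≡ d mod p → a + c ≡ b + d mod p
  +-cong-mod {a} {b} {c} {d} (congruent p∣a-b) (congruent p∣c-d) = via (regroup a b c d) (Signed.∣m∣n⇒∣m+n p∣a-b p∣c-d)
    where
    regroup : ∀ a b c d → (a - b) + (c - d) ≡ (a + c) - (b + d)
    regroup = solve-∀

  +-congˡ-mod : ∀ c {a b} → a ≡ b mod p → c + a ≡ c + b mod p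
  +-congˡ-mod c = +-cong-mod (≡⇒≡-mod {a = c} refl)

  *-congˡ-mod : ∀ c {a b} → a ≡ b mod p → c * a ≡ c * b mod p
  *-congˡ-mod c {a} {b} (congruent p∣a-b) = via (distrib c a b) (Signed.∣n⇒∣m*n c p∣a-b)
    where
    distrib : ∀ c a b → c * (a - b) ≡ c * a - c * b
    distrib = solve-∀

  *-congʳ-mod : ∀ c {a b} → a ≡ b mod p → a * c ≡ b * c mod p
  *-congʳ-mod c {a} {b} a≡b = subst₂ (λ x y → x ≡ y mod p) (*-comm c a) (*-comm c b) (*-congˡ-mod c a≡b)

  *-cong-mod : ∀ {a b c d} → a ≡ b mod p → c ≡ d mod p → a * c ≡ b * d mod p
  *-cong-mod {b = b} {c} a≡b c≡d = mod-trans (*-congʳ-mod c a≡b) (*-congˡ-mod b c≡d)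

  ∣⇒≡0-mod : ∀ {a} → + p Signed.∣ a → a ≡ 0ℤ mod p
  ∣⇒≡0-mod {a} p∣a = via (sym (+-identityʳ a)) p∣a

  square-cong-mod : ∀ a b → a ℕ.+ b ≡ p → + a * + a ≡ + b * + b mod p
  square-cong-mod a b a+b≡p = mod-sym (congruent (divides (+ b - + a) (begin
    + b * + b - + a * + a      ≡⟨ difference (+ b) (+ a) ⟩
    (+ b - + a) * (+ a + + b)  ≡⟨ cong ((+ b - + a) *_) (trans (sym (pos-+ a b)) (cong +_ a+b≡p)) ⟩
    (+ b - + a) * + p          ∎)))
    where
    open ≡-Reasoning
    difference : ∀ b a → b * b - a * a ≡ (b - a) * (a + b)
    difference = solve-∀

  sumBelow-cong-mod : ∀ N {f g : ℕ → ℤ} → (∀ k → k < N → f k ≡ g k mod p) → sumBelow N f ≡ sumBelow N g mod p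
  sumBelow-cong-mod zero    _   = ≡⇒≡-mod refl
  sumBelow-cong-mod (suc N) f≡g =
    +-cong-mod (sumBelow-cong-mod N (λ k k<N → f≡g k (ℕₚ.m<n⇒m<1+n k<N))) (f≡g N (ℕₚ.n<1+n N))

  sumBelow-extend-mod : ∀ M N (f : ℕ → ℤ) → (∀ j → f (M ℕ.+ j) ≡ 0ℤ mod p) →
    sumBelow (M ℕ.+ N) f ≡ sumBelow M f mod p
  sumBelow-extend-mod M N f f≡0 = begin
    sumBelow (M ℕ.+ N) f                           ≡⟨ sumBelow-split M N f ⟩
    sumBelow M f + sumBelow N (λ j → f (M ℕ.+ j))  ≈⟨ +-congˡ-mod (sumBelow M f) (sumBelow-cong-mod N (λ j _ → f≡0 j)) ⟩
    sumBelow M f + sumBelow N (λ _ → 0ℤ)           ≡⟨ cong (λ t → sumBelow M f + t) (sumBelow-zero N (λ _ _ → refl)) ⟩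
    sumBelow M f + 0ℤ                              ≡⟨ +-identityʳ _ ⟩
    sumBelow M f                                   ∎
    where open ≡-mod-Reasoning p

congModQ-/ : ∀ {p d a b N} .{{_ : ℕ.NonZero d}} → Prime p → ¬ p ∣ d → + d * a ≡ N * b mod p →
  ¬ p ∣ ↧ₙ (N / d) × CongModQ a (N / d) b p
congModQ-/ {p} {d} {a} {b} {N} pp p∤d (congruent p∣da-Nb) = p∤↧c , p∣X
  where
  open ≡-Reasoning
  c : ℚ
  c = N / d
  g X : ℤ
  g = ℤGCD.gcd N (+ d)
  X = a * ↧ c - ↥ c * b
  ↧c*g≡d : ↧ₙ c ℕ.* ∣ g ∣ ≡ d
  ↧c*g≡d = trans (sym (abs-* (↧ c) g)) (cong ∣_∣ (ℚₚ.↧-/ N d))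
  p∤↧c : ¬ p ∣ ↧ₙ c
  p∤↧c p∣↧c = p∤d (ℕ∣.∣-trans p∣↧c (divides ∣ g ∣ (trans (sym ↧c*g≡d) (ℕₚ.*-comm (↧ₙ c) ∣ g ∣))))
  factor : + d * a - N * b ≡ g * X
  factor = begin
    + d * a - N * b              ≡⟨ cong₂ (λ x y → x * a - y * b) (ℚₚ.↧-/ N d) (ℚₚ.↥-/ N d) ⟨
    ↧ c * g * a - ↥ c * g * b    ≡⟨ pull (↧ c) (↥ c) g a b ⟩
    g * X                        ∎
    where
    pull : ∀ x y g a b → x * g * a - y * g * b ≡ g * (a * x - y * b)
    pull = solve-∀
  p∣X : p ∣ ∣ X ∣
  p∣X with euclidsLemma ∣ g ∣ ∣ X ∣ pp (subst (p ∣_) (trans (cong ∣_∣ factor) (abs-* g X)) (Signed.∣⇒∣ᵤ p∣da-Nb))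
  ... | inj₁ p∣g = ⊥-elim (p∤d (ℕ∣.∣-trans p∣g (divides (↧ₙ c) (sym ↧c*g≡d))))
  ... | inj₂ p∣X = p∣X

coeffMoment : ℕ → ℕ → ℕ → ℤ
coeffMoment N m i = sumBelow N (λ k → (+ (2 ℕ.* k ℕ.+ 1)) ^ (2 ℕ.* m) * + D-coeff k i)

^-2*suc : ∀ x m → x ^ (2 ℕ.* suc m) ≡ x * x * x ^ (2 ℕ.* m)
^-2*suc x m = begin
  x ^ (2 ℕ.* suc m)        ≡⟨ cong (x ^_) (double-suc m) ⟩
  x ^ (2 ℕ.+ 2 ℕ.* m)      ≡⟨ ^-distribˡ-+-* x 2 (2 ℕ.* m) ⟩
  x * (x * 1ℤ) * x ^ (2 ℕ.* m) ≡⟨ cong (λ t → x * t * x ^ (2 ℕ.* m)) (*-identityʳ x) ⟩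
  x * x * x ^ (2 ℕ.* m)    ∎
  where
  open ≡-Reasoning
  double-suc : ∀ m → 2 ℕ.* suc m ≡ 2 ℕ.+ 2 ℕ.* m
  double-suc = ℕ-solve-∀

pos-square-* : ∀ a x → + (a ℕ.* a ℕ.* x) ≡ + a * + a * + x
pos-square-* a x = trans (pos-* (a ℕ.* a) x) (cong (_* + x) (pos-* a a))

D-coeff-recurrenceℤ : ∀ k i → + (2 ℕ.* k ℕ.+ 1) * + (2 ℕ.* k ℕ.+ 1) * + D-coeff k i
  ≡ + (2 ℕ.* i ℕ.+ 1) * + (2 ℕ.* i ℕ.+ 1) * + D-coeff k i + + (2 ℕ.* i ℕ.+ 2) * + (2 ℕ.* i ℕ.+ 2) * + D-coeff k (suc i)
D-coeff-recurrenceℤ k i = begin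
  + (2 ℕ.* k ℕ.+ 1) * + (2 ℕ.* k ℕ.+ 1) * + D-coeff k i       ≡⟨ pos-square-* (2 ℕ.* k ℕ.+ 1) _ ⟨
  + ((2 ℕ.* k ℕ.+ 1) ℕ.* (2 ℕ.* k ℕ.+ 1) ℕ.* D-coeff k i)     ≡⟨ cong +_ (D-coeff-recurrence k i) ⟩
  + (a ℕ.* a ℕ.* D-coeff k i ℕ.+ b ℕ.* b ℕ.* D-coeff k (suc i)) ≡⟨ pos-+ (a ℕ.* a ℕ.* D-coeff k i) _ ⟩
  + (a ℕ.* a ℕ.* D-coeff k i) + + (b ℕ.* b ℕ.* D-coeff k (suc i))
    ≡⟨ cong₂ _+_ (pos-square-* a (D-coeff k i)) (pos-square-* b (D-coeff k (suc i))) ⟩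
  + a * + a * + D-coeff k i + + b * + b * + D-coeff k (suc i)  ∎
  where
  open ≡-Reasoning
  a b : ℕ
  a = 2 ℕ.* i ℕ.+ 1
  b = 2 ℕ.* i ℕ.+ 2

coeffMoment-suc : ∀ N m i → coeffMoment N (suc m) i
  ≡ + (2 ℕ.* i ℕ.+ 1) * + (2 ℕ.* i ℕ.+ 1) * coeffMoment N m i
    + + (2 ℕ.* i ℕ.+ 2) * + (2 ℕ.* i ℕ.+ 2) * coeffMoment N m (suc i)
coeffMoment-suc N m i = begin
  sumBelow N (λ k → x k ^ (2 ℕ.* suc m) * + D-coeff k i)
    ≡⟨ sumBelow-cong N (λ k _ → termwise k) ⟩
  sumBelow N (λ k → a * (x k ^ (2 ℕ.* m) * + D-coeff k i) + b * (x k ^ (2 ℕ.* m) * + D-coeff k (suc i)))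
    ≡⟨ sumBelow-+ N _ _ ⟩
  sumBelow N (λ k → a * (x k ^ (2 ℕ.* m) * + D-coeff k i)) + sumBelow N (λ k → b * (x k ^ (2 ℕ.* m) * + D-coeff k (suc i)))
    ≡⟨ cong₂ _+_ (sumBelow-*ˡ N a _) (sumBelow-*ˡ N b _) ⟩
  a * coeffMoment N m i + b * coeffMoment N m (suc i) ∎
  where
  open ≡-Reasoning
  x : ℕ → ℤ
  x k = + (2 ℕ.* k ℕ.+ 1)
  a b : ℤ
  a = + (2 ℕ.* i ℕ.+ 1) * + (2 ℕ.* i ℕ.+ 1)
  b = + (2 ℕ.* i ℕ.+ 2) * + (2 ℕ.* i ℕ.+ 2)
  pull : ∀ x y d → x * x * y * d ≡ y * (x * x * d)
  pull = solve-∀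
  push : ∀ y a d b d′ → y * (a * d + b * d′) ≡ a * (y * d) + b * (y * d′)
  push = solve-∀
  termwise : ∀ k → x k ^ (2 ℕ.* suc m) * + D-coeff k i
                   ≡ a * (x k ^ (2 ℕ.* m) * + D-coeff k i) + b * (x k ^ (2 ℕ.* m) * + D-coeff k (suc i))
  termwise k = begin
    x k ^ (2 ℕ.* suc m) * + D-coeff k i                   ≡⟨ cong (_* + D-coeff k i) (^-2*suc (x k) m) ⟩
    x k * x k * y * + D-coeff k i                         ≡⟨ pull (x k) y (+ D-coeff k i) ⟩
    y * (x k * x k * + D-coeff k i)                       ≡⟨ cong (y *_) (D-coeff-recurrenceℤ k i) ⟩
    y * (a * + D-coeff k i + b * + D-coeff k (suc i))     ≡⟨ push y a (+ D-coeff k i) b (+ D-coeff k (suc i)) ⟩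
    a * (y * + D-coeff k i) + b * (y * + D-coeff k (suc i)) ∎
    where
    y : ℤ
    y = x k ^ (2 ℕ.* m)

D-coeff-sum : ∀ i N → + (2 ℕ.* i ℕ.+ 1) * sumBelow N (λ k → + D-coeff k i) ≡ + ((N ℕ.∸ i) ℕ.* D-coeff N i)
D-coeff-sum i zero    = trans (*-zeroʳ (+ (2 ℕ.* i ℕ.+ 1))) (cong (λ n → + (n ℕ.* D-coeff 0 i)) (sym (ℕₚ.0∸n≡0 i)))
D-coeff-sum i (suc N) = begin
  c * (sumBelow N (λ k → + D-coeff k i) + + δ)           ≡⟨ *-distribˡ-+ c (sumBelow N (λ k → + D-coeff k i)) (+ δ) ⟩
  c * sumBelow N (λ k → + D-coeff k i) + c * + δ         ≡⟨ cong (_+ c * + δ) (D-coeff-sum i N) ⟩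
  + ((N ℕ.∸ i) ℕ.* δ) + c * + δ                         ≡⟨ +-comm (+ ((N ℕ.∸ i) ℕ.* δ)) (c * + δ) ⟩
  c * + δ + + ((N ℕ.∸ i) ℕ.* δ)                         ≡⟨ cong (_+ + ((N ℕ.∸ i) ℕ.* δ)) (pos-* (2 ℕ.* i ℕ.+ 1) δ) ⟨
  + ((2 ℕ.* i ℕ.+ 1) ℕ.* δ) + + ((N ℕ.∸ i) ℕ.* δ)        ≡⟨ pos-+ ((2 ℕ.* i ℕ.+ 1) ℕ.* δ) _ ⟨
  + ((2 ℕ.* i ℕ.+ 1) ℕ.* δ ℕ.+ (N ℕ.∸ i) ℕ.* δ)          ≡⟨ cong +_ (D-coeff-sum-step i N) ⟩
  + ((suc N ℕ.∸ i) ℕ.* D-coeff (suc N) i)               ∎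
  where
  open ≡-Reasoning
  c = + (2 ℕ.* i ℕ.+ 1)
  δ : ℕ
  δ = D-coeff N i

D≡sumBelow : ∀ z {k N} → k ℕ.< N → D k z ≡ sumBelow N (λ i → + D-coeff k i * z ^ i)
D≡sumBelow z {k} {N} k<N = begin
  sumBelow (suc k) f                        ≡⟨ sumBelow-extend (suc k) (N ℕ.∸ suc k) f vanish ⟨
  sumBelow (suc k ℕ.+ (N ℕ.∸ suc k)) f      ≡⟨ cong (λ L → sumBelow L f) (ℕₚ.m+[n∸m]≡n k<N) ⟩
  sumBelow N f                              ∎
  where
  open ≡-Reasoning
  f : ℕ → ℤ
  f = λ i → + D-coeff k i * z ^ i
  vanish : ∀ j → f (suc k ℕ.+ j) ≡ 0ℤ
  vanish j = cong (λ d → + d * z ^ (suc k ℕ.+ j)) (D-coeff-below (ℕₚ.m≤m+n (suc k) j))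

delannoyMoment : ℕ → ℤ → ℕ → ℤ
delannoyMoment N z m = sumBelow N (λ k → (+ (2 ℕ.* k ℕ.+ 1)) ^ (2 ℕ.* m) * D k z)

delannoyMoment-expansion : ∀ z N m → delannoyMoment N z m ≡ sumBelow N (λ i → z ^ i * coeffMoment N m i)
delannoyMoment-expansion z N m = begin
  sumBelow N (λ k → w k * D k z)
    ≡⟨ sumBelow-cong N (λ k k<N → cong (w k *_) (D≡sumBelow z k<N)) ⟩
  sumBelow N (λ k → w k * sumBelow N (λ i → + D-coeff k i * z ^ i))
    ≡⟨ sumBelow-cong N (λ k _ → sym (sumBelow-*ˡ N (w k) _)) ⟩
  sumBelow N (λ k → sumBelow N (λ i → w k * (+ D-coeff k i * z ^ i)))
    ≡⟨ sumBelow-cong N (λ k _ → sumBelow-cong N (λ i _ → rotate (w k) (+ D-coeff k i) (z ^ i))) ⟩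
  sumBelow N (λ k → sumBelow N (λ i → z ^ i * (w k * + D-coeff k i)))
    ≡⟨ sumBelow-swap N N _ ⟩
  sumBelow N (λ i → sumBelow N (λ k → z ^ i * (w k * + D-coeff k i)))
    ≡⟨ sumBelow-cong N (λ i _ → sumBelow-*ˡ N (z ^ i) _) ⟩
  sumBelow N (λ i → z ^ i * coeffMoment N m i) ∎
  where
  open ≡-Reasoning
  w : ℕ → ℤ
  w k = (+ (2 ℕ.* k ℕ.+ 1)) ^ (2 ℕ.* m)
  rotate : ∀ a b c → a * (b * c) ≡ c * (a * b)
  rotate = solve-∀

-- The recurrence of coeffMoment-suc with 2i+1 and 2i+2 replaced by −2d and −(2d−1), their residues
-- modulo 2n+1 when d = n − i.
β : ℕ → ℕ → ℤ
β zero    zero    = 1ℤ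
β zero    (suc d) = 0ℤ
β (suc m) zero    = 0ℤ
β (suc m) (suc d) = + (2 ℕ.* suc d) * + (2 ℕ.* suc d) * β m (suc d) + + (2 ℕ.* d ℕ.+ 1) * + (2 ℕ.* d ℕ.+ 1) * β m d

β-above : ∀ m j → β m (suc m ℕ.+ j) ≡ 0ℤ
β-above zero    j = refl
β-above (suc m) j = begin
  a * a * β m (suc (suc m ℕ.+ j)) + b * b * β m (suc m ℕ.+ j)
    ≡⟨ cong (λ d → a * a * β m d + b * b * β m (suc m ℕ.+ j)) (ℕₚ.+-suc (suc m) j) ⟨
  a * a * β m (suc m ℕ.+ suc j) + b * b * β m (suc m ℕ.+ j)
    ≡⟨ cong₂ (λ x y → a * a * x + b * b * y) (β-above m (suc j)) (β-above m j) ⟩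
  a * a * 0ℤ + b * b * 0ℤ ≡⟨ zeros a b ⟩
  0ℤ ∎
  where
  open ≡-Reasoning
  a b : ℤ
  a = + (2 ℕ.* suc (suc m ℕ.+ j))
  b = + (2 ℕ.* (suc m ℕ.+ j) ℕ.+ 1)
  zeros : ∀ a b → a * a * 0ℤ + b * b * 0ℤ ≡ 0ℤ
  zeros = solve-∀

βpoly : ℤ → ℕ → ℕ → ℤ
βpoly z m e = sumBelow (suc e) (λ d → z ^ (e ℕ.∸ d) * β m d)

*-βpoly : ∀ z a m e → z ^ a * βpoly z m e ≡ sumBelow (suc e) (λ d → z ^ ((a ℕ.+ e) ℕ.∸ d) * β m d)
*-βpoly z a m e = trans (sym (sumBelow-*ˡ (suc e) (z ^ a) _)) (sumBelow-cong (suc e) merge)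
  where
  merge : ∀ d → d ℕ.< suc e → z ^ a * (z ^ (e ℕ.∸ d) * β m d) ≡ z ^ ((a ℕ.+ e) ℕ.∸ d) * β m d
  merge d d<1+e = begin
    z ^ a * (z ^ (e ℕ.∸ d) * β m d)     ≡⟨ *-assoc (z ^ a) _ _ ⟨
    z ^ a * z ^ (e ℕ.∸ d) * β m d       ≡⟨ cong (_* β m d) (^-distribˡ-+-* z a (e ℕ.∸ d)) ⟨
    z ^ (a ℕ.+ (e ℕ.∸ d)) * β m d       ≡⟨ cong (λ x → z ^ x * β m d) (ℕₚ.+-∸-assoc a (ℕₚ.≤-pred d<1+e)) ⟨
    z ^ ((a ℕ.+ e) ℕ.∸ d) * β m d       ∎
    where open ≡-Reasoning

module _ {n : ℕ} (pp : Prime (2 ℕ.* n ℕ.+ 1)) where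

  private
    P : ℕ
    P = 2 ℕ.* n ℕ.+ 1

    H : ℤ
    H = coeffMoment P 0 n

  β≡0-mod : ∀ m j → β m (suc n ℕ.+ j) ≡ 0ℤ mod P
  β≡0-mod zero    j       = ≡⇒≡-mod refl
  β≡0-mod (suc m) zero    = begin
    a * a * β m (suc n ℕ.+ 0) + b * b * β m (n ℕ.+ 0)
      ≈⟨ +-cong-mod (*-congˡ-mod (a * a) (β≡0-mod m 0)) (*-congʳ-mod (β m (n ℕ.+ 0)) (square-cong-mod _ 0 (P≡ n))) ⟩
    a * a * 0ℤ + 0ℤ * 0ℤ * β m (n ℕ.+ 0)   ≡⟨ zeros (a * a) (β m (n ℕ.+ 0)) ⟩
    0ℤ                                     ∎
    where
    open ≡-mod-Reasoning P
    a b : ℤ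
    a = + (2 ℕ.* suc (n ℕ.+ 0))
    b = + (2 ℕ.* (n ℕ.+ 0) ℕ.+ 1)
    P≡ : ∀ n → 2 ℕ.* (n ℕ.+ 0) ℕ.+ 1 ℕ.+ 0 ≡ 2 ℕ.* n ℕ.+ 1
    P≡ = ℕ-solve-∀
    zeros : ∀ c x → c * 0ℤ + 0ℤ * 0ℤ * x ≡ 0ℤ
    zeros = solve-∀
  β≡0-mod (suc m) (suc j) = begin
    a * a * β m (suc n ℕ.+ suc j) + b * b * β m (n ℕ.+ suc j)
      ≈⟨ +-cong-mod (*-congˡ-mod (a * a) (β≡0-mod m (suc j)))
                    (*-congˡ-mod (b * b) (subst (λ d → β m d ≡ 0ℤ mod P) (sym (ℕₚ.+-suc n j)) (β≡0-mod m j))) ⟩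
    a * a * 0ℤ + b * b * 0ℤ  ≡⟨ zeros (a * a) (b * b) ⟩
    0ℤ                       ∎
    where
    open ≡-mod-Reasoning P
    a b : ℤ
    a = + (2 ℕ.* suc (n ℕ.+ suc j))
    b = + (2 ℕ.* (n ℕ.+ suc j) ℕ.+ 1)
    zeros : ∀ c d → c * 0ℤ + d * 0ℤ ≡ 0ℤ
    zeros = solve-∀

  coeffMoment-above : ∀ m i → n ℕ.< i → coeffMoment P m i ≡ 0ℤ mod P
  coeffMoment-above m i n<i = begin
    coeffMoment P m i            ≈⟨ sumBelow-cong-mod P (λ k k<P → *-congˡ-mod (w k) (P∣D-coeff k<P)) ⟩
    sumBelow P (λ k → w k * 0ℤ)  ≡⟨ sumBelow-zero P (λ k _ → *-zeroʳ (w k)) ⟩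
    0ℤ                           ∎
    where
    open ≡-mod-Reasoning P
    w : ℕ → ℤ
    w k = (+ (2 ℕ.* k ℕ.+ 1)) ^ (2 ℕ.* m)
    P≡ : ∀ n → 2 ℕ.* n ℕ.+ 1 ≡ n ℕ.+ suc n
    P≡ = ℕ-solve-∀
    P≤2i : P ℕ.≤ i ℕ.+ i
    P≤2i = subst (ℕ._≤ i ℕ.+ i) (sym (P≡ n)) (ℕₚ.+-mono-≤ (ℕₚ.<⇒≤ n<i) n<i)
    P∣D-coeff : ∀ {k} → k ℕ.< P → + D-coeff k i ≡ 0ℤ mod P
    P∣D-coeff k<P = ∣⇒≡0-mod (Signed.∣ᵤ⇒∣ (prime∣D-coeff {i = i} pp k<P P≤2i))

  coeffMoment-below : ∀ i → i ℕ.< n → coeffMoment P 0 i ≡ 0ℤ mod P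
  coeffMoment-below i i<n = begin
    coeffMoment P 0 i                  ≡⟨ sumBelow-cong P (λ k _ → *-identityˡ (+ D-coeff k i)) ⟩
    sumBelow P (λ k → + D-coeff k i)
      ≈⟨ ∣⇒≡0-mod (Signed.∣ᵤ⇒∣ (ℤCoprime.coprime-divisor (+ P) (+ (2 ℕ.* i ℕ.+ 1)) _ coprime P∣odd*sum)) ⟩
    0ℤ                                 ∎
    where
    open ≡-mod-Reasoning P
    2i+1<P : 2 ℕ.* i ℕ.+ 1 ℕ.< P
    2i+1<P = ℕₚ.+-monoˡ-< 1 (ℕₚ.*-monoʳ-< 2 i<n)
    coprime : Coprime P (2 ℕ.* i ℕ.+ 1)
    coprime = prime⇒coprime pp {{ℕ.>-nonZero (ℕₚ.m≤n+m 1 (2 ℕ.* i))}} 2i+1<P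
    P∣odd*sum : P ∣ ∣ + (2 ℕ.* i ℕ.+ 1) * sumBelow P (λ k → + D-coeff k i) ∣
    P∣odd*sum = subst (λ x → P ∣ ∣ x ∣) (sym (D-coeff-sum i P))
      (prime∣[p∸i]*D-coeff i pp (ℕₚ.≤-<-trans (ℕₚ.m≤n*m i 2) (ℕₚ.<-trans (ℕₚ.m<m+n (2 ℕ.* i) ℕ.z<s) 2i+1<P)))

  coeffMoment≡β : ∀ m d i → i ℕ.+ d ≡ n → coeffMoment P m i ≡ β m d * H mod P
  coeffMoment≡β zero zero i i+0≡n with refl ← trans (sym (ℕₚ.+-identityʳ i)) i+0≡n =
    ≡⇒≡-mod (sym (*-identityˡ H))
  coeffMoment≡β zero (suc d) i i+d+1≡n =
    mod-trans (coeffMoment-below i (subst (i ℕ.<_) i+d+1≡n (ℕₚ.m<m+n i ℕ.z<s))) (≡⇒≡-mod (sym (*-zeroˡ H)))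
  coeffMoment≡β (suc m) zero i i+0≡n with refl ← trans (sym (ℕₚ.+-identityʳ i)) i+0≡n = begin
    coeffMoment P (suc m) n
      ≡⟨ coeffMoment-suc P m n ⟩
    a * a * coeffMoment P m n + b * b * coeffMoment P m (suc n)
      ≈⟨ +-cong-mod (*-congʳ-mod (coeffMoment P m n) (square-cong-mod P 0 (ℕₚ.+-identityʳ P)))
                    (*-congˡ-mod (b * b) (coeffMoment-above m (suc n) (ℕₚ.n<1+n n))) ⟩
    0ℤ * 0ℤ * coeffMoment P m n + b * b * 0ℤ
      ≡⟨ zeros (coeffMoment P m n) (b * b) H ⟩
    0ℤ * H ∎
    where
    open ≡-mod-Reasoning P
    a b : ℤ
    a = + (2 ℕ.* n ℕ.+ 1)
    b = + (2 ℕ.* n ℕ.+ 2)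
    zeros : ∀ u c h → 0ℤ * 0ℤ * u + c * 0ℤ ≡ 0ℤ * h
    zeros = solve-∀
  coeffMoment≡β (suc m) (suc e) i i+e+1≡n = begin
    coeffMoment P (suc m) i
      ≡⟨ coeffMoment-suc P m i ⟩
    a * a * coeffMoment P m i + b * b * coeffMoment P m (suc i)
      ≈⟨ +-cong-mod (*-cong-mod odd≡even (coeffMoment≡β m (suc e) i i+e+1≡n))
                    (*-cong-mod even≡odd (coeffMoment≡β m e (suc i) i+1+e≡n)) ⟩
    c * c * (β m (suc e) * H) + d * d * (β m e * H)
      ≡⟨ factor (c * c) (β m (suc e)) (d * d) (β m e) H ⟩
    β (suc m) (suc e) * H ∎
    where
    open ≡-mod-Reasoning P
    a b c d : ℤ
    a = + (2 ℕ.* i ℕ.+ 1)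
    b = + (2 ℕ.* i ℕ.+ 2)
    c = + (2 ℕ.* suc e)
    d = + (2 ℕ.* e ℕ.+ 1)
    i+1+e≡n : suc i ℕ.+ e ≡ n
    i+1+e≡n = trans (sym (ℕₚ.+-suc i e)) i+e+1≡n
    odd+even : ∀ i e → 2 ℕ.* i ℕ.+ 1 ℕ.+ 2 ℕ.* suc e ≡ 2 ℕ.* (i ℕ.+ suc e) ℕ.+ 1
    odd+even = ℕ-solve-∀
    even+odd : ∀ i e → 2 ℕ.* i ℕ.+ 2 ℕ.+ (2 ℕ.* e ℕ.+ 1) ≡ 2 ℕ.* (i ℕ.+ suc e) ℕ.+ 1
    even+odd = ℕ-solve-∀
    odd+even≡P : 2 ℕ.* i ℕ.+ 1 ℕ.+ 2 ℕ.* suc e ≡ P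
    odd+even≡P = trans (odd+even i e) (cong (λ t → 2 ℕ.* t ℕ.+ 1) i+e+1≡n)
    even+odd≡P : 2 ℕ.* i ℕ.+ 2 ℕ.+ (2 ℕ.* e ℕ.+ 1) ≡ P
    even+odd≡P = trans (even+odd i e) (cong (λ t → 2 ℕ.* t ℕ.+ 1) i+e+1≡n)
    odd≡even : a * a ≡ c * c mod P
    odd≡even = square-cong-mod (2 ℕ.* i ℕ.+ 1) (2 ℕ.* suc e) odd+even≡P
    even≡odd : b * b ≡ d * d mod P
    even≡odd = square-cong-mod (2 ℕ.* i ℕ.+ 2) (2 ℕ.* e ℕ.+ 1) even+odd≡P
    factor : ∀ c x d y h → c * (x * h) + d * (y * h) ≡ (c * x + d * y) * h
    factor = solve-∀

  delannoyMoment≡βpoly : ∀ z m → delannoyMoment P z m ≡ βpoly z m n * H mod P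
  delannoyMoment≡βpoly z m = begin
    delannoyMoment P z m                                        ≡⟨ delannoyMoment-expansion z P m ⟩
    sumBelow P F                                                ≡⟨ cong (λ L → sumBelow L F) (P≡ n) ⟩
    sumBelow (suc n ℕ.+ n) F                                    ≈⟨ sumBelow-extend-mod (suc n) n F high ⟩
    sumBelow (suc n) F                                          ≈⟨ sumBelow-cong-mod (suc n) low ⟩
    sumBelow (suc n) (λ i → z ^ i * (β m (n ℕ.∸ i) * H))        ≡⟨ sumBelow-reverse n _ ⟩
    sumBelow (suc n) (λ d → z ^ (n ℕ.∸ d) * (β m (n ℕ.∸ (n ℕ.∸ d)) * H))
      ≡⟨ sumBelow-cong (suc n) (λ d d<1+n → cong (λ x → z ^ (n ℕ.∸ d) * (β m x * H)) (ℕₚ.m∸[m∸n]≡n (ℕₚ.≤-pred d<1+n))) ⟩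
    sumBelow (suc n) (λ d → z ^ (n ℕ.∸ d) * (β m d * H))
      ≡⟨ sumBelow-cong (suc n) (λ d _ → sym (*-assoc (z ^ (n ℕ.∸ d)) (β m d) H)) ⟩
    sumBelow (suc n) (λ d → z ^ (n ℕ.∸ d) * β m d * H)          ≡⟨ sumBelow-*ʳ (suc n) H _ ⟩
    βpoly z m n * H                                             ∎
    where
    open ≡-mod-Reasoning P
    F : ℕ → ℤ
    F i = z ^ i * coeffMoment P m i
    P≡ : ∀ n → 2 ℕ.* n ℕ.+ 1 ≡ suc n ℕ.+ n
    P≡ = ℕ-solve-∀
    high : ∀ j → F (suc n ℕ.+ j) ≡ 0ℤ mod P
    high j = mod-trans (*-congˡ-mod (z ^ (suc n ℕ.+ j)) (coeffMoment-above m (suc n ℕ.+ j) (ℕ.s≤s (ℕₚ.m≤m+n n j))))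
                       (≡⇒≡-mod (*-zeroʳ (z ^ (suc n ℕ.+ j))))
    low : ∀ i → i ℕ.< suc n → F i ≡ z ^ i * (β m (n ℕ.∸ i) * H) mod P
    low i i≤n = *-congˡ-mod (z ^ i) (coeffMoment≡β m (n ℕ.∸ i) i (ℕₚ.m+[n∸m]≡n (ℕₚ.≤-pred i≤n)))

  βpoly-reflect : ∀ z m → z ^ m * βpoly z m n ≡ z ^ n * βpoly z m m mod P
  βpoly-reflect z m = begin
    z ^ m * βpoly z m n          ≡⟨ *-βpoly z m m n ⟩
    sumBelow (suc n) τ′          ≡⟨ sumBelow-cong (suc n) (λ d _ → cong (λ e → z ^ (e ℕ.∸ d) * β m d) (ℕₚ.+-comm m n)) ⟩
    sumBelow (suc n) τ           ≈⟨ mod-sym (sumBelow-extend-mod (suc n) m τ beyond-n) ⟩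
    sumBelow (suc n ℕ.+ m) τ     ≡⟨ cong (λ L → sumBelow L τ) (trans (ℕₚ.+-comm (suc n) m) (ℕₚ.+-suc m n)) ⟩
    sumBelow (suc m ℕ.+ n) τ     ≡⟨ sumBelow-extend (suc m) n τ beyond-m ⟩
    sumBelow (suc m) τ           ≡⟨ *-βpoly z n m m ⟨
    z ^ n * βpoly z m m          ∎
    where
    open ≡-mod-Reasoning P
    τ τ′ : ℕ → ℤ
    τ  d = z ^ ((n ℕ.+ m) ℕ.∸ d) * β m d
    τ′ d = z ^ ((m ℕ.+ n) ℕ.∸ d) * β m d
    beyond-n : ∀ j → τ (suc n ℕ.+ j) ≡ 0ℤ mod P
    beyond-n j = mod-trans (*-congˡ-mod w (β≡0-mod m j)) (≡⇒≡-mod (*-zeroʳ w))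
      where w = z ^ ((n ℕ.+ m) ℕ.∸ (suc n ℕ.+ j))
    beyond-m : ∀ j → τ (suc m ℕ.+ j) ≡ 0ℤ
    beyond-m j = trans (cong (w *_) (β-above m j)) (*-zeroʳ w)
      where w = z ^ ((n ℕ.+ m) ℕ.∸ (suc m ℕ.+ j))

  delannoyMoment-zero : ∀ z → delannoyMoment P z 0 ≡ z ^ n * H mod P
  delannoyMoment-zero z = begin
    delannoyMoment P z 0   ≈⟨ delannoyMoment≡βpoly z 0 ⟩
    βpoly z 0 n * H        ≡⟨ cong (_* H) (*-identityˡ (βpoly z 0 n)) ⟨
    1ℤ * βpoly z 0 n * H   ≈⟨ *-congʳ-mod H (βpoly-reflect z 0) ⟩
    z ^ n * 1ℤ * H         ≡⟨ cong (_* H) (*-identityʳ (z ^ n)) ⟩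
    z ^ n * H              ∎
    where open ≡-mod-Reasoning P

  delannoyMoment-congruence : ∀ z m → z ^ m * delannoyMoment P z m ≡ βpoly z m m * delannoyMoment P z 0 mod P
  delannoyMoment-congruence z m = begin
    z ^ m * delannoyMoment P z m        ≈⟨ *-congˡ-mod (z ^ m) (delannoyMoment≡βpoly z m) ⟩
    z ^ m * (βpoly z m n * H)           ≡⟨ *-assoc (z ^ m) (βpoly z m n) H ⟨
    z ^ m * βpoly z m n * H             ≈⟨ *-congʳ-mod H (βpoly-reflect z m) ⟩
    z ^ n * βpoly z m m * H             ≡⟨ swap (z ^ n) (βpoly z m m) H ⟩
    βpoly z m m * (z ^ n * H)           ≈⟨ *-congˡ-mod (βpoly z m m) (mod-sym (delannoyMoment-zero z)) ⟩
    βpoly z m m * delannoyMoment P z 0  ∎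
    where
    open ≡-mod-Reasoning P
    swap : ∀ a b h → a * b * h ≡ b * (a * h)
    swap = solve-∀


  weighted-sum-congruence : ∀ z r → let m = suc r in
    + (∣ z ∣ ℕ.^ m ℕ.* ∣ z ∣ ℕ.^ m) * sumBelow P (λ k → (+ (2 ℕ.* k ℕ.+ 1)) ^ (2 ℕ.* r ℕ.+ 2) * D k z)
      ≡ z ^ m * βpoly z m m * sumBelow P (λ k → D k z) mod P
  weighted-sum-congruence z r = begin
    + (∣ z ∣ ℕ.^ m ℕ.* ∣ z ∣ ℕ.^ m) * L           ≡⟨ cong₂ _*_ (+[∣i∣^n*∣i∣^n]≡i^n*i^n z m) L≡ ⟩
    z ^ m * z ^ m * delannoyMoment P z m          ≡⟨ *-assoc (z ^ m) (z ^ m) _ ⟩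
    z ^ m * (z ^ m * delannoyMoment P z m)        ≈⟨ *-congˡ-mod (z ^ m) (delannoyMoment-congruence z m) ⟩
    z ^ m * (βpoly z m m * delannoyMoment P z 0)  ≡⟨ *-assoc (z ^ m) (βpoly z m m) _ ⟨
    z ^ m * βpoly z m m * delannoyMoment P z 0    ≡⟨ cong (z ^ m * βpoly z m m *_) R≡ ⟩
    z ^ m * βpoly z m m * R                       ∎
    where
    open ≡-mod-Reasoning P
    m : ℕ
    m = suc r
    L R : ℤ
    L = sumBelow P (λ k → (+ (2 ℕ.* k ℕ.+ 1)) ^ (2 ℕ.* r ℕ.+ 2) * D k z)
    R = sumBelow P (λ k → D k z)
    two-suc : ∀ r → 2 ℕ.* r ℕ.+ 2 ≡ 2 ℕ.* suc r
    two-suc = ℕ-solve-∀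
    L≡ : L ≡ delannoyMoment P z m
    L≡ = sumBelow-cong P (λ k _ → cong (λ e → (+ (2 ℕ.* k ℕ.+ 1)) ^ e * D k z) (two-suc r))
    R≡ : delannoyMoment P z 0 ≡ R
    R≡ = sumBelow-cong P (λ k _ → *-identityˡ (D k z))

DelannoyCongruence : ℤ → ℕ → ℚ → ℕ → Set
DelannoyCongruence z r c p =
  ¬ p ∣ ↧ₙ c ×
  CongModQ (sumBelow p (λ k → (+ (2 ℕ.* k ℕ.+ 1)) ^ (2 ℕ.* r ℕ.+ 2) * D k z)) c (sumBelow p (λ k → D k z)) p

theorem3p6 : (z : ℤ) → z ≢ + 0 → (r : ℕ) →
    Σ ℚ (λ c → (p : ℕ) → Prime p → p ≢ 2 → gcd p ∣ z ∣ ≡ 1 →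
    (¬ (p ∣ (↧ₙ c))) ×
    CongModQ (sumBelow p (λ k → ((+ (2 ℕ.* k ℕ.+ 1)) ℤ.^ (2 ℕ.* r ℕ.+ 2)) ℤ.* D k z))
    c
    (sumBelow p (λ k → D k z))
    p)
theorem3p6 z z≢0 r = c , at-prime
  where
  m : ℕ
  m = suc r
  instance
    ∣z∣≢0 : ℕ.NonZero ∣ z ∣
    ∣z∣≢0 = ℕ.≢-nonZero (λ ∣z∣≡0 → z≢0 (∣i∣≡0⇒i≡0 ∣z∣≡0))
  d : ℕ
  d = ∣ z ∣ ℕ.^ m ℕ.* ∣ z ∣ ℕ.^ m
  instance
    d≢0 : ℕ.NonZero d
    d≢0 = ℕₚ.m*n≢0 _ _ {{ℕₚ.m^n≢0 ∣ z ∣ m}} {{ℕₚ.m^n≢0 ∣ z ∣ m}}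
  -- c = βpoly z m m / z ^ m, written over the positive denominator z ^ (2m).
  c : ℚ
  c = (z ^ m * βpoly z m m) / d
  at-prime : (p : ℕ) → Prime p → p ≢ 2 → gcd p ∣ z ∣ ≡ 1 → DelannoyCongruence z r c p
  at-prime p pp p≢2 gcd≡1 with n , refl ← odd-prime pp p≢2 =
    congModQ-/ {N = z ^ m * βpoly z m m} pp (prime∤* pp p∤∣z∣ᵐ p∤∣z∣ᵐ) (weighted-sum-congruence {n} pp z r)
    where
    p∤∣z∣ᵐ : ¬ p ∣ ∣ z ∣ ℕ.^ m
    p∤∣z∣ᵐ = prime∤^ pp (prime∤⇐gcd≡1 pp gcd≡1) m
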